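{- For any matroid $M$ and any positive integer $k$, $T^k_M(1,\dots,1;1,\dots,1)=|\mathcal{B}|$, where $\mathcal{B}$ is the set of bases of $M$.
   Context: For a matroid $M$ on ground set $\mathcal{A}$ with rank function $\mathrm{rk}$, $T^k_M((x_i)_1^k;(y_i)_1^k)=\sum_{S_1\subseteq\cdots\subseteq S_k\subseteq\mathcal{A}}\prod_{i=1}^k(x_i-1)^{\mathrm{rk}(\mathcal{A})-\mathrm{rk}(S_i)}(y_i-1)^{|S_i|-\mathrm{rk}(S_i)}$ (sum over weakly increasing chains of $k$ subsets), regarded as a polynomial. -}

module Defs where

open import Data.Nat as ℕ using (ℕ; zero; suc; _≤_; _∸_)
open import Data.Integer as ℤ using (ℤ; _-_; _*_; _+_; _^_)
open import Data.Fin using (Fin)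
open import Data.Fin.Subset using (Subset; _⊆_; _∪_; _∩_; ∣_∣; ⊤; inside; outside)
open import Data.Fin.Subset.Properties using (_⊆?_)
open import Data.Vec as Vec using (Vec; []; _∷_)
open import Data.List as List using (List; []; _∷_; _++_; map; concatMap; filterᵇ; foldr)
open import Data.Bool using (Bool; true; false; _∧_)
open import Relation.Nullary.Decidable using (does)
open import Relation.Binary.PropositionalEquality using (_≡_)

record Matroid (n : ℕ) : Set where
  field
    rk         : Subset n → ℕ
    rk-bound   : ∀ S → rk S ≤ ∣ S ∣
    rk-mono    : ∀ S T → S ⊆ T → rk S ≤ rk T
    rk-submod  : ∀ S T → rk (S ∪ T) ℕ.+ rk (S ∩ T) ≤ rk S ℕ.+ rk T

open Matroid public

Independent : ∀ {n} → Matroid n → Subset n → Set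
Independent M S = rk M S ≡ ∣ S ∣

IsBasis : ∀ {n} → Matroid n → Subset n → Set
IsBasis M B = Independent M B × (∀ T → B ⊆ T → Independent M T → T ≡ B)
  where open import Data.Product using (_×_)

allSubsets : (n : ℕ) → List (Subset n)
allSubsets zero    = [] ∷ []
allSubsets (suc n) = map (outside ∷_) (allSubsets n) ++ map (inside ∷_) (allSubsets n)

allTuples : (n k : ℕ) → List (Vec (Subset n) k)
allTuples n zero    = [] ∷ []
allTuples n (suc k) = concatMap (λ S → map (S ∷_) (allTuples n k)) (allSubsets n)

isChain : ∀ {n k} → Vec (Subset n) k → Bool
isChain []            = true
isChain (S ∷ [])      = true
isChain (S ∷ T ∷ Ss)  = does (S ⊆? T) ∧ isChain (T ∷ Ss)

chains : (n k : ℕ) → List (Vec (Subset n) k)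
chains n k = filterᵇ isChain (allTuples n k)

sumℤ : List ℤ → ℤ
sumℤ = foldr _+_ (ℤ.+ 0)

chainTerm : ∀ {n k} → Matroid n → Vec ℤ k → Vec ℤ k → Vec (Subset n) k → ℤ
chainTerm M []       []       []       = ℤ.+ 1
chainTerm M (x ∷ xs) (y ∷ ys) (S ∷ Ss) =
  ((x - ℤ.+ 1) ^ (rk M ⊤ ∸ rk M S)) * ((y - ℤ.+ 1) ^ (∣ S ∣ ∸ rk M S))
  * chainTerm M xs ys Ss

-- The polynomial T^k_M evaluated at integer points (x_i), (y_i)
-- (polynomial evaluation: 0^0 = 1).
Tk : ∀ {n} (k : ℕ) → Matroid n → Vec ℤ k → Vec ℤ k → ℤ
Tk k M xs ys = sumℤ (map (chainTerm M xs ys) (chains _ k))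

{-# OPTIONS --safe #-}
module Submission where

-- At x = y = 1 each factor of a chain term is 0^(rk A - rk S) 0^(|S| - rk S), which is
-- 1 exactly when S is independent and spanning, i.e. a basis, and 0 otherwise.  So only
-- chains consisting of bases contribute, and since a basis contained in an independent
-- set equals it, such a chain is constant: there is one contributing chain per basis.

open import Defs
open import Data.Bool as Bool using (Bool; true; false; _∧_)
open import Data.Fin.Subset using (Subset; _⊆_; _∪_; _∩_; ∣_∣; ⊤; ⁅_⁆; ⋃; inside; outside)
open import Data.Fin.Subset.Properties
  using (_⊆?_; ⊆-refl; ⊆⊤; drop-∷-⊆; p⊆q⇒∣p∣≤∣q∣; p⊆p∪q; q⊆p∪q; x∈p∪q⁻; x∈p∪q⁺; x∈p∩q⁺;
         x∈⁅x⁆; ∣⁅x⁆∣≡1; ∪-identityʳ)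
open import Data.Integer using (ℤ; +_; _+_; _*_; _^_)
import Data.Integer.Properties as ℤ
open import Algebra.Properties.CommutativeSemigroup ℤ.*-commutativeSemigroup
  using (interchange; xy∙z≈y∙xz)
open import Data.List using (List; []; _∷_; _++_; length; map; allFin; filter; filterᵇ; concatMap)
open import Data.List.Membership.Propositional using (_∈_)
open import Data.List.Membership.Propositional.Properties
  using (∈-map⁺; ∈-map⁻; ∈-allFin; ∈-++⁺ˡ; ∈-++⁺ʳ; ∈-filter⁺; ∈-filter⁻)
open import Data.List.Properties using (map-cong; map-∘)
open import Data.List.Relation.Unary.All as All using (All; []; _∷_)
open import Data.List.Relation.Unary.AllPairs using ([]; _∷_)
open import Data.List.Relation.Unary.Any using (here; there)
open import Data.List.Relation.Unary.Unique.Propositional using (Unique)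
import Data.List.Relation.Unary.Unique.Propositional.Properties as Unique
open import Data.Nat as ℕ using (ℕ; zero; suc; _≤_; _<_; _∸_; z≤n; s≤s)
open import Data.Nat.Properties as ℕ
  using (≤-trans; ≤-reflexive; ≤-antisym; <-irrefl; ≰⇒>; _≤?_; +-mono-≤; +-cancelʳ-≤; module ≤-Reasoning)
open import Data.Product using (Σ; _×_; _,_; proj₁; proj₂)
open import Data.Sum using (inj₁; inj₂; [_,_])
open import Data.Vec using (Vec; _∷_; []; here; replicate)
open import Data.Vec.Properties using (∷-injectiveʳ; ≡-dec)
open import Function using (_∘_)
open import Function.Bundles using (_⇔_; mk⇔)
open import Function.Properties.Equivalence using () renaming (sym to ⇔-sym)
open import Relation.Binary.Definitions using (DecidableEquality)
open import Relation.Binary.PropositionalEquality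
  using (_≡_; _≢_; refl; sym; trans; cong; cong₂; module ≡-Reasoning)
open import Relation.Nullary using (Dec; does; yes; no; ¬_; contradiction)
import Relation.Nullary.Decidable as Dec
open import Relation.Nullary.Decidable using (_×-dec_; dec-true; dec-false; does-⇔)

p⊆q∧∣q∣≤∣p∣⇒p≡q : ∀ {n} {p q : Subset n} → p ⊆ q → ∣ q ∣ ≤ ∣ p ∣ → p ≡ q
p⊆q∧∣q∣≤∣p∣⇒p≡q {p = []}          {[]}          _   _ = refl
p⊆q∧∣q∣≤∣p∣⇒p≡q {p = outside ∷ p} {outside ∷ q} p⊆q le =
  cong (outside ∷_) (p⊆q∧∣q∣≤∣p∣⇒p≡q (drop-∷-⊆ p⊆q) le)
p⊆q∧∣q∣≤∣p∣⇒p≡q {p = outside ∷ p} {inside ∷ q}  p⊆q le =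
  contradiction (≤-trans le (p⊆q⇒∣p∣≤∣q∣ (drop-∷-⊆ p⊆q))) (<-irrefl refl)
p⊆q∧∣q∣≤∣p∣⇒p≡q {p = inside ∷ p}  {outside ∷ q} p⊆q _  with p⊆q here
... | ()
p⊆q∧∣q∣≤∣p∣⇒p≡q {p = inside ∷ p}  {inside ∷ q}  p⊆q (s≤s le) =
  cong (inside ∷_) (p⊆q∧∣q∣≤∣p∣⇒p≡q (drop-∷-⊆ p⊆q) le)

∣p∪q∣≤∣p∣+∣q∣ : ∀ {n} (p q : Subset n) → ∣ p ∪ q ∣ ≤ ∣ p ∣ ℕ.+ ∣ q ∣
∣p∪q∣≤∣p∣+∣q∣ []            []            = z≤n
∣p∪q∣≤∣p∣+∣q∣ (outside ∷ p) (outside ∷ q) = ∣p∪q∣≤∣p∣+∣q∣ p q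
∣p∪q∣≤∣p∣+∣q∣ (outside ∷ p) (inside ∷ q)  =
  ≤-trans (s≤s (∣p∪q∣≤∣p∣+∣q∣ p q)) (≤-reflexive (sym (ℕ.+-suc ∣ p ∣ ∣ q ∣)))
∣p∪q∣≤∣p∣+∣q∣ (inside ∷ p)  (outside ∷ q) = s≤s (∣p∪q∣≤∣p∣+∣q∣ p q)
∣p∪q∣≤∣p∣+∣q∣ (inside ∷ p)  (inside ∷ q)  =
  s≤s (≤-trans (ℕ.m≤n⇒m≤1+n (∣p∪q∣≤∣p∣+∣q∣ p q)) (≤-reflexive (sym (ℕ.+-suc ∣ p ∣ ∣ q ∣))))

X⊆⋃ : ∀ {n} {X : Subset n} {Xs} → X ∈ Xs → X ⊆ ⋃ Xs
X⊆⋃ {Xs = X ∷ Xs} (here refl) = p⊆p∪q (⋃ Xs)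
X⊆⋃ {Xs = Y ∷ Xs} (there X∈Xs) = q⊆p∪q Y (⋃ Xs) ∘ X⊆⋃ X∈Xs

⊤⊆⋃singletons : ∀ {n} → ⊤ ⊆ ⋃ (map ⁅_⁆ (allFin n))
⊤⊆⋃singletons {x = x} _ = X⊆⋃ (∈-map⁺ ⁅_⁆ (∈-allFin x)) (x∈⁅x⁆ x)

module _ {n} (M : Matroid n) where

  Spanning : Subset n → Set
  Spanning S = rk M S ≡ rk M ⊤

  rk-∪-absorb : ∀ B X Y → rk M (B ∪ X) ≤ rk M B → rk M (B ∪ Y) ≤ rk M B →
                rk M (B ∪ (X ∪ Y)) ≤ rk M B
  rk-∪-absorb B X Y BX≤B BY≤B = +-cancelʳ-≤ (rk M B) _ _ (begin
      rk M (B ∪ (X ∪ Y)) ℕ.+ rk M B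
    ≤⟨ +-mono-≤ (rk-mono M _ _ B∪X∪Y⊆BX∪BY) (rk-mono M _ _ B⊆BX∩BY) ⟩
      rk M ((B ∪ X) ∪ (B ∪ Y)) ℕ.+ rk M ((B ∪ X) ∩ (B ∪ Y))
    ≤⟨ rk-submod M (B ∪ X) (B ∪ Y) ⟩
      rk M (B ∪ X) ℕ.+ rk M (B ∪ Y)
    ≤⟨ +-mono-≤ BX≤B BY≤B ⟩
      rk M B ℕ.+ rk M B ∎)
    where
    open ≤-Reasoning
    B∪X∪Y⊆BX∪BY : B ∪ (X ∪ Y) ⊆ (B ∪ X) ∪ (B ∪ Y)
    B∪X∪Y⊆BX∪BY = x∈p∪q⁺
      ∘ [ inj₁ ∘ p⊆p∪q X , [ inj₁ ∘ q⊆p∪q B X , inj₂ ∘ q⊆p∪q B Y ] ∘ x∈p∪q⁻ X Y ]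
      ∘ x∈p∪q⁻ B (X ∪ Y)
    B⊆BX∩BY : B ⊆ (B ∪ X) ∩ (B ∪ Y)
    B⊆BX∩BY x∈B = x∈p∩q⁺ (p⊆p∪q X x∈B , p⊆p∪q Y x∈B)

  rk-∪-⋃ : ∀ B Xs → All (λ X → rk M (B ∪ X) ≤ rk M B) Xs → rk M (B ∪ ⋃ Xs) ≤ rk M B
  rk-∪-⋃ B []       []         = ≤-reflexive (cong (rk M) (∪-identityʳ B))
  rk-∪-⋃ B (X ∷ Xs) (BX≤B ∷ h) = rk-∪-absorb B X (⋃ Xs) BX≤B (rk-∪-⋃ B Xs h)

  spanning-if-no-element-raises-rk : ∀ B → (∀ e → rk M (B ∪ ⁅ e ⁆) ≤ rk M B) → Spanning B
  spanning-if-no-element-raises-rk B h = ≤-antisym (rk-mono M B ⊤ ⊆⊤) (begin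
      rk M ⊤                                 ≤⟨ rk-mono M _ _ (q⊆p∪q B _ ∘ ⊤⊆⋃singletons) ⟩
      rk M (B ∪ ⋃ (map ⁅_⁆ (allFin n)))      ≤⟨ rk-∪-⋃ B _ (All.tabulate singleton≤) ⟩
      rk M B                                 ∎)
    where
    open ≤-Reasoning
    singleton≤ : ∀ {X} → X ∈ map ⁅_⁆ (allFin n) → rk M (B ∪ X) ≤ rk M B
    singleton≤ X∈ with ∈-map⁻ ⁅_⁆ X∈
    ... | e , _ , refl = h e

  basis⇒no-element-raises-rk : ∀ {B} → IsBasis M B → ∀ e → rk M (B ∪ ⁅ e ⁆) ≤ rk M B
  basis⇒no-element-raises-rk {B} (indB , maximal) e with rk M (B ∪ ⁅ e ⁆) ≤? rk M B
  ... | yes ≤B = ≤B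
  ... | no ≰B = contradiction (cong (rk M) (maximal _ (p⊆p∪q ⁅ e ⁆) indBe)) (ℕ.>⇒≢ B<Be)
    where
    B<Be : rk M B < rk M (B ∪ ⁅ e ⁆)
    B<Be = ≰⇒> ≰B
    indBe : Independent M (B ∪ ⁅ e ⁆)
    indBe = ≤-antisym (rk-bound M _) (begin
      ∣ B ∪ ⁅ e ⁆ ∣          ≤⟨ ∣p∪q∣≤∣p∣+∣q∣ B ⁅ e ⁆ ⟩
      ∣ B ∣ ℕ.+ ∣ ⁅ e ⁆ ∣    ≡⟨ cong₂ ℕ._+_ (sym indB) (∣⁅x⁆∣≡1 e) ⟩
      rk M B ℕ.+ 1           ≡⟨ ℕ.+-comm (rk M B) 1 ⟩
      suc (rk M B)           ≤⟨ B<Be ⟩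
      rk M (B ∪ ⁅ e ⁆)       ∎)
      where open ≤-Reasoning

  IsBasis⇔Independent×Spanning : ∀ B → IsBasis M B ⇔ (Independent M B × Spanning B)
  IsBasis⇔Independent×Spanning B = mk⇔
    (λ basis → proj₁ basis , spanning-if-no-element-raises-rk B (basis⇒no-element-raises-rk basis))
    (λ (indB , spanB) → indB , λ T B⊆T indT → sym (p⊆q∧∣q∣≤∣p∣⇒p≡q B⊆T (begin
      ∣ T ∣     ≡⟨ sym indT ⟩
      rk M T    ≤⟨ rk-mono M T ⊤ ⊆⊤ ⟩
      rk M ⊤    ≡⟨ trans (sym spanB) indB ⟩
      ∣ B ∣     ∎)))
    where open ≤-Reasoning

  -- Decided through the rank conditions, so that  does (isBasis? M B)  computes to their conjunction.
  isBasis? : ∀ B → Dec (IsBasis M B)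
  isBasis? B = Dec.map (⇔-sym (IsBasis⇔Independent×Spanning B))
                       ((rk M B ℕ.≟ ∣ B ∣) ×-dec (rk M B ℕ.≟ rk M ⊤))

_≟ₛ_ : ∀ {n} → DecidableEquality (Subset n)
_≟ₛ_ = ≡-dec Bool._≟_

∈-allSubsets : ∀ {n} (S : Subset n) → S ∈ allSubsets n
∈-allSubsets []            = here refl
∈-allSubsets (outside ∷ S) = ∈-++⁺ˡ (∈-map⁺ (outside ∷_) (∈-allSubsets S))
∈-allSubsets (inside ∷ S)  = ∈-++⁺ʳ _ (∈-map⁺ (inside ∷_) (∈-allSubsets S))

allSubsets-unique : ∀ n → Unique (allSubsets n)
allSubsets-unique zero    = [] ∷ []
allSubsets-unique (suc n) =
  Unique.++⁺ (Unique.map⁺ ∷-injectiveʳ (allSubsets-unique n))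
             (Unique.map⁺ ∷-injectiveʳ (allSubsets-unique n))
             heads-differ
  where
  heads-differ : ∀ {S} → ¬ (S ∈ map (outside ∷_) (allSubsets n) × S ∈ map (inside ∷_) (allSubsets n))
  heads-differ (S∈out , S∈in) with ∈-map⁻ (outside ∷_) S∈out | ∈-map⁻ (inside ∷_) S∈in
  ... | _ , _ , refl | _ , _ , ()

𝟙 : Bool → ℤ
𝟙 true  = + 1
𝟙 false = + 0

𝟙-∧ : ∀ a b → 𝟙 (a ∧ b) ≡ 𝟙 a * 𝟙 b
𝟙-∧ true  true  = refl
𝟙-∧ true  false = refl
𝟙-∧ false _     = refl

module _ {A : Set} where

  ∑ : List A → (A → ℤ) → ℤ
  ∑ xs f = sumℤ (map f xs)

  ∑-cong : ∀ {f g : A → ℤ} → (∀ x → f x ≡ g x) → ∀ xs → ∑ xs f ≡ ∑ xs g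
  ∑-cong f≗g xs = cong sumℤ (map-cong f≗g xs)

  ∑-++ : ∀ xs ys (f : A → ℤ) → ∑ (xs ++ ys) f ≡ ∑ xs f + ∑ ys f
  ∑-++ []       ys f = sym (ℤ.+-identityˡ _)
  ∑-++ (x ∷ xs) ys f = trans (cong (_+_ (f x)) (∑-++ xs ys f)) (sym (ℤ.+-assoc (f x) _ _))

  ∑-*ˡ : ∀ c xs (f : A → ℤ) → ∑ xs (λ x → c * f x) ≡ c * ∑ xs f
  ∑-*ˡ c []       f = sym (ℤ.*-zeroʳ c)
  ∑-*ˡ c (x ∷ xs) f = trans (cong (_+_ (c * f x)) (∑-*ˡ c xs f)) (sym (ℤ.*-distribˡ-+ c (f x) _))

  ∑-filterᵇ : ∀ (p : A → Bool) xs f → ∑ (filterᵇ p xs) f ≡ ∑ xs (λ x → 𝟙 (p x) * f x)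
  ∑-filterᵇ p []       f = refl
  ∑-filterᵇ p (x ∷ xs) f with p x
  ... | true  = cong₂ _+_ (sym (ℤ.*-identityˡ (f x))) (∑-filterᵇ p xs f)
  ... | false = trans (∑-filterᵇ p xs f) (sym (ℤ.+-identityˡ _))

  ∑-𝟙≡length-filter : ∀ {P : A → Set} (P? : ∀ x → Dec (P x)) xs →
                      ∑ xs (𝟙 ∘ does ∘ P?) ≡ + length (filter P? xs)
  ∑-𝟙≡length-filter P? []       = refl
  ∑-𝟙≡length-filter P? (x ∷ xs) with does (P? x)
  ... | true  = cong (_+_ (+ 1)) (∑-𝟙≡length-filter P? xs)
  ... | false = trans (ℤ.+-identityˡ _) (∑-𝟙≡length-filter P? xs)

  module _ (_≟_ : DecidableEquality A) where

    ∑-𝟙-≟-∉ : ∀ {x} xs → All (x ≢_) xs → ∑ xs (λ y → 𝟙 (does (y ≟ x))) ≡ + 0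
    ∑-𝟙-≟-∉ []       []           = refl
    ∑-𝟙-≟-∉ (y ∷ ys) (x≢y ∷ x∉ys) rewrite dec-false (y ≟ _) (x≢y ∘ sym) =
      trans (ℤ.+-identityˡ _) (∑-𝟙-≟-∉ ys x∉ys)

    ∑-𝟙-≟-unique : ∀ {x xs} → Unique xs → x ∈ xs → ∑ xs (λ y → 𝟙 (does (y ≟ x))) ≡ + 1
    ∑-𝟙-≟-unique {x} (x∉ys ∷ _) (here refl) rewrite dec-true (x ≟ x) refl | ∑-𝟙-≟-∉ _ x∉ys = refl
    ∑-𝟙-≟-unique {x} {y ∷ ys} (y∉ys ∷ uniq) (there x∈ys)
      rewrite dec-false (y ≟ x) (λ { refl → All.lookup y∉ys x∈ys refl }) =
        trans (ℤ.+-identityˡ _) (∑-𝟙-≟-unique uniq x∈ys)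

module _ {A B : Set} where

  ∑-map : ∀ (g : A → B) xs (f : B → ℤ) → ∑ (map g xs) f ≡ ∑ xs (f ∘ g)
  ∑-map g xs f = cong sumℤ (sym (map-∘ xs))

  ∑-concatMap : ∀ (h : A → List B) xs (f : B → ℤ) → ∑ (concatMap h xs) f ≡ ∑ xs (λ x → ∑ (h x) f)
  ∑-concatMap h []       f = refl
  ∑-concatMap h (x ∷ xs) f = trans (∑-++ (h x) _ f) (cong (_+_ (∑ (h x) f)) (∑-concatMap h xs f))

0^[n∸m]≡𝟙[m≟n] : ∀ {m n} → m ≤ n → (+ 0) ^ (n ∸ m) ≡ 𝟙 (does (m ℕ.≟ n))
0^[n∸m]≡𝟙[m≟n] {n = zero}  z≤n       = refl
0^[n∸m]≡𝟙[m≟n] {n = suc n} z≤n       = refl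
0^[n∸m]≡𝟙[m≟n]             (s≤s m≤n) = 0^[n∸m]≡𝟙[m≟n] m≤n

𝟙[d]*x≡𝟙[d] : ∀ {P : Set} (d : Dec P) {x} → (P → x ≡ + 1) → 𝟙 (does d) * x ≡ 𝟙 (does d)
𝟙[d]*x≡𝟙[d] (yes p) x≡1 = trans (ℤ.*-identityˡ _) (x≡1 p)
𝟙[d]*x≡𝟙[d] (no _)  _   = refl

module _ {n} (M : Matroid n) where

  basis-⊆⇔≡ : ∀ {S T} → IsBasis M S → (S ⊆ T × IsBasis M T) ⇔ (T ≡ S)
  basis-⊆⇔≡ basisS@(_ , maximal) =
    mk⇔ (λ (S⊆T , indT , _) → maximal _ S⊆T indT) (λ { refl → ⊆-refl , basisS })

  -- The factor of chainTerm at x = y = 1, where x - 1 reduces to + 0.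
  weightAtOne : Subset n → ℤ
  weightAtOne S = (+ 0) ^ (rk M ⊤ ∸ rk M S) * (+ 0) ^ (∣ S ∣ ∸ rk M S)

  weightAtOne≡𝟙[isBasis] : ∀ S → weightAtOne S ≡ 𝟙 (does (isBasis? M S))
  weightAtOne≡𝟙[isBasis] S = begin
    weightAtOne S
      ≡⟨ cong₂ _*_ (0^[n∸m]≡𝟙[m≟n] (rk-mono M S ⊤ ⊆⊤)) (0^[n∸m]≡𝟙[m≟n] (rk-bound M S)) ⟩
    𝟙 (does (rk M S ℕ.≟ rk M ⊤)) * 𝟙 (does (rk M S ℕ.≟ ∣ S ∣))
      ≡⟨ ℤ.*-comm (𝟙 (does (rk M S ℕ.≟ rk M ⊤))) _ ⟩
    𝟙 (does (rk M S ℕ.≟ ∣ S ∣)) * 𝟙 (does (rk M S ℕ.≟ rk M ⊤))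
      ≡⟨ sym (𝟙-∧ (does (rk M S ℕ.≟ ∣ S ∣)) _) ⟩
    𝟙 (does (isBasis? M S)) ∎
    where open ≡-Reasoning

  chainWeight : ∀ {k} → Vec (Subset n) k → ℤ
  chainWeight {k} = chainTerm M (replicate k (+ 1)) (replicate k (+ 1))

  chainsFrom : ℕ → Subset n → ℤ
  chainsFrom k S = ∑ (allTuples n k) (λ Ss → 𝟙 (isChain (S ∷ Ss)) * chainWeight (S ∷ Ss))

  chainsFrom-suc : ∀ k S →
    chainsFrom (suc k) S ≡ ∑ (allSubsets n) (λ T → (𝟙 (does (S ⊆? T)) * weightAtOne S) * chainsFrom k T)
  chainsFrom-suc k S = begin
    chainsFrom (suc k) S
      ≡⟨ ∑-concatMap (λ T → map (T ∷_) (allTuples n k)) (allSubsets n) _ ⟩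
    ∑ (allSubsets n) (λ T → ∑ (map (T ∷_) (allTuples n k)) (λ Ss → 𝟙 (isChain (S ∷ Ss)) * chainWeight (S ∷ Ss)))
      ≡⟨ ∑-cong (λ T → trans (∑-map (T ∷_) (allTuples n k) _) (factor T)) (allSubsets n) ⟩
    ∑ (allSubsets n) (λ T → (𝟙 (does (S ⊆? T)) * weightAtOne S) * chainsFrom k T) ∎
    where
    open ≡-Reasoning
    factor : ∀ T → ∑ (allTuples n k) (λ Ss → 𝟙 (isChain (S ∷ T ∷ Ss)) * chainWeight (S ∷ T ∷ Ss))
                 ≡ (𝟙 (does (S ⊆? T)) * weightAtOne S) * chainsFrom k T
    factor T = trans
      (∑-cong (λ Ss → trans
                 (cong (_* (weightAtOne S * chainWeight (T ∷ Ss))) (𝟙-∧ (does (S ⊆? T)) (isChain (T ∷ Ss))))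
                 (interchange (𝟙 (does (S ⊆? T))) _ (weightAtOne S) _))
              (allTuples n k))
      (∑-*ˡ (𝟙 (does (S ⊆? T)) * weightAtOne S) (allTuples n k) _)

  ∑-bases-above : ∀ S →
    ∑ (allSubsets n) (λ T → (𝟙 (does (S ⊆? T)) * 𝟙 (does (isBasis? M S))) * 𝟙 (does (isBasis? M T)))
      ≡ 𝟙 (does (isBasis? M S))
  ∑-bases-above S = begin
    ∑ (allSubsets n) (λ T → (𝟙 (does (S ⊆? T)) * 𝟙 (does (isBasis? M S))) * 𝟙 (does (isBasis? M T)))
      ≡⟨ ∑-cong (λ T → trans (xy∙z≈y∙xz (𝟙 (does (S ⊆? T))) (𝟙 (does (isBasis? M S))) _)
                             (cong (𝟙 (does (isBasis? M S)) *_) (sym (𝟙-∧ (does (S ⊆? T)) _))))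
                (allSubsets n) ⟩
    ∑ (allSubsets n) (λ T → 𝟙 (does (isBasis? M S)) * 𝟙 (does (S ⊆? T ×-dec isBasis? M T)))
      ≡⟨ ∑-*ˡ (𝟙 (does (isBasis? M S))) (allSubsets n) _ ⟩
    𝟙 (does (isBasis? M S)) * ∑ (allSubsets n) (λ T → 𝟙 (does (S ⊆? T ×-dec isBasis? M T)))
      ≡⟨ 𝟙[d]*x≡𝟙[d] (isBasis? M S) only-S-itself ⟩
    𝟙 (does (isBasis? M S)) ∎
    where
    open ≡-Reasoning
    only-S-itself : IsBasis M S → ∑ (allSubsets n) (λ T → 𝟙 (does (S ⊆? T ×-dec isBasis? M T))) ≡ + 1
    only-S-itself basisS = trans
      (∑-cong (λ T → cong 𝟙 (does-⇔ (basis-⊆⇔≡ basisS) (S ⊆? T ×-dec isBasis? M T) (T ≟ₛ S))) (allSubsets n))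
      (∑-𝟙-≟-unique _≟ₛ_ (allSubsets-unique n) (∈-allSubsets S))

  chainsFrom≡𝟙[isBasis] : ∀ k S → chainsFrom k S ≡ 𝟙 (does (isBasis? M S))
  chainsFrom≡𝟙[isBasis] zero    S = begin
    + 1 * (weightAtOne S * + 1) + + 0  ≡⟨ ℤ.+-identityʳ _ ⟩
    + 1 * (weightAtOne S * + 1)        ≡⟨ ℤ.*-identityˡ _ ⟩
    weightAtOne S * + 1                ≡⟨ ℤ.*-identityʳ _ ⟩
    weightAtOne S                      ≡⟨ weightAtOne≡𝟙[isBasis] S ⟩
    𝟙 (does (isBasis? M S))            ∎
    where open ≡-Reasoning
  chainsFrom≡𝟙[isBasis] (suc k) S = begin
    chainsFrom (suc k) S
      ≡⟨ chainsFrom-suc k S ⟩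
    ∑ (allSubsets n) (λ T → (𝟙 (does (S ⊆? T)) * weightAtOne S) * chainsFrom k T)
      ≡⟨ ∑-cong (λ T → cong₂ (λ w c → (𝟙 (does (S ⊆? T)) * w) * c)
                             (weightAtOne≡𝟙[isBasis] S) (chainsFrom≡𝟙[isBasis] k T)) (allSubsets n) ⟩
    ∑ (allSubsets n) (λ T → (𝟙 (does (S ⊆? T)) * 𝟙 (does (isBasis? M S))) * 𝟙 (does (isBasis? M T)))
      ≡⟨ ∑-bases-above S ⟩
    𝟙 (does (isBasis? M S)) ∎
    where open ≡-Reasoning

  Tk-at-ones : ∀ k → Tk (suc k) M (replicate (suc k) (+ 1)) (replicate (suc k) (+ 1))
                       ≡ ∑ (allSubsets n) (𝟙 ∘ does ∘ isBasis? M)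
  Tk-at-ones k = begin
    ∑ (filterᵇ isChain (allTuples n (suc k))) chainWeight
      ≡⟨ ∑-filterᵇ isChain (allTuples n (suc k)) chainWeight ⟩
    ∑ (allTuples n (suc k)) (λ v → 𝟙 (isChain v) * chainWeight v)
      ≡⟨ ∑-concatMap (λ S → map (S ∷_) (allTuples n k)) (allSubsets n) _ ⟩
    ∑ (allSubsets n) (λ S → ∑ (map (S ∷_) (allTuples n k)) (λ v → 𝟙 (isChain v) * chainWeight v))
      ≡⟨ ∑-cong (λ S → trans (∑-map (S ∷_) (allTuples n k) _) (chainsFrom≡𝟙[isBasis] k S)) (allSubsets n) ⟩
    ∑ (allSubsets n) (𝟙 ∘ does ∘ isBasis? M) ∎
    where open ≡-Reasoning

proposition5p1 : (n : ℕ) (M : Matroid n) (k : ℕ) → 1 ≤ k →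
    Σ (List (Subset n)) λ bases →
      Unique bases × (∀ B → (B ∈ bases) ⇔ IsBasis M B) ×
      (Tk k M (replicate k (+ 1)) (replicate k (+ 1)) ≡ + (length bases))
proposition5p1 n M (suc k) _ =
    filter (isBasis? M) (allSubsets n)
  , Unique.filter⁺ (isBasis? M) (allSubsets-unique n)
  , (λ B → mk⇔ (proj₂ ∘ ∈-filter⁻ (isBasis? M) {xs = allSubsets n}) (∈-filter⁺ (isBasis? M) (∈-allSubsets B)))
  , trans (Tk-at-ones M k) (∑-𝟙≡length-filter (isBasis? M) (allSubsets n))
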